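{- Let $I$ be an instance, $\Sigma_{\mathrm{FD}}$ a conjunction of functional dependencies, and $F\neq F'$ two $R$-facts of $I$. Assume there is a position $R^p$ such that, writing $O=\mathrm{NDng}(R^p)$, we have $\mathrm{OVL}(F,F')\subsetneq O$ and $\{\pi_O(F),\pi_O(F')\}$ is not a violation of $\Sigma_{\mathrm{FD}}|_O$. Then $\{F,F'\}$ is not a violation of $\Sigma_{\mathrm{FD}}$.
   Context: An FD $R^L\to R^r$ ($L$ a nonempty set of positions) states that two $R$-facts agreeing on $L$ agree on $R^r$; two facts violate it if they agree on $L$ but not on $R^r$; $R^L\to O$ denotes the conjunction of $R^L\to R^o$ for $R^o\in O$. For $R^p$, let $\mathrm{Dng}(R^p)$ be the positions $R^r\neq R^p$ such that the unary FD $R^r\to R^p$ is implied by $\Sigma_{\mathrm{FD}}$, and $\mathrm{NDng}(R^p)=\mathrm{Pos}(R)\setminus(\{R^p\}\cup\mathrm{Dng}(R^p))$. $\mathrm{OVL}(R(\mathbf a),R(\mathbf b))=\{R^s:a_s=b_s\}$. $\pi_O(F)$ is the projection of $F$ to the positions of $O$, viewed as a fact of an $|O|$-ary relation indexed by $O$. The FD projection $\Sigma_{\mathrm{FD}}|_O$ consists of the FDs $R^L\to R^r$ of $\Sigma_{\mathrm{FD}}$ with $R^L\subseteq O$ and $R^r\in O$, plus, for every FD $R^L\to R^r$ of $\Sigma_{\mathrm{FD}}$ with $R^L\subseteq O$ and $R^r\notin O$, the key dependency $R^L\to O$. -}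

module Defs where

open import Data.Nat using (ℕ)
open import Data.Fin using (Fin)
open import Data.List using (List)
open import Data.List.Membership.Propositional using (_∈_)
open import Data.Product using (Σ; ∃; _×_; _,_; proj₁)
open import Data.Sum using (_⊎_)
open import Relation.Nullary using (¬_)
open import Relation.Binary.PropositionalEquality using (_≡_; _≢_)

-- Constants are natural numbers (an infinite domain).
-- A fact of a relation whose positions are indexed by a type P
-- assigns a constant to every position.
Fact : Set → Set
Fact P = P → ℕ

record FD (P : Set) : Set₁ where
  constructor _⟶_
  field
    lhs : P → Set
    rhs : P
open FD public

NonemptyLhs : {P : Set} → FD P → Set
NonemptyLhs fd = ∃ λ q → lhs fd q

AgreeOn : {P : Set} → (P → Set) → Fact P → Fact P → Set
AgreeOn L F G = ∀ q → L q → F q ≡ G q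

ViolatesFD : {P : Set} → FD P → Fact P → Fact P → Set
ViolatesFD fd F G = AgreeOn (lhs fd) F G × F (rhs fd) ≢ G (rhs fd)

Violation : {P : Set} → (FD P → Set₁) → Fact P → Fact P → Set₁
Violation S F G = ∃ λ fd → S fd × ViolatesFD fd F G

SatisfiesFD : {P : Set} → List (Fact P) → FD P → Set
SatisfiesFD J fd = ∀ F G → F ∈ J → G ∈ J → ¬ ViolatesFD fd F G

Satisfies : {P : Set} → List (Fact P) → List (FD P) → Set₁
Satisfies J Σfd = ∀ fd → fd ∈ Σfd → SatisfiesFD J fd

Implies : {P : Set} → List (FD P) → FD P → Set₁
Implies {P} Σfd fd = ∀ (J : List (Fact P)) → Satisfies J Σfd → SatisfiesFD J fd

unaryFD : {P : Set} → P → P → FD P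
unaryFD r p = (λ q → q ≡ r) ⟶ p

module _ {n : ℕ} (Σfd : List (FD (Fin n))) where

  Dng : Fin n → Fin n → Set₁
  Dng p r = r ≢ p × Implies Σfd (unaryFD r p)

  NDng : Fin n → Fin n → Set₁
  NDng p q = q ≢ p × ¬ Dng p q

OVL : {n : ℕ} → Fact (Fin n) → Fact (Fin n) → Fin n → Set
OVL F G q = F q ≡ G q

_⊊_ : {n : ℕ} {a b : _} → (Fin n → Set a) → (Fin n → Set b) → Set _
A ⊊ B = (∀ q → A q → B q) × ∃ λ q → B q × ¬ A q

PosIn : {n : ℕ} → (Fin n → Set₁) → Set₁
PosIn {n} O = Σ (Fin n) O

π : {n : ℕ} (O : Fin n → Set₁) → Fact (Fin n) → (PosIn O → ℕ)
π O F q = F (proj₁ q)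

record FD₁ (P : Set₁) : Set₂ where
  constructor _⟹_
  field
    lhs₁ : P → Set
    rhs₁ : P
open FD₁ public

AgreeOn₁ : {P : Set₁} → (P → Set) → (P → ℕ) → (P → ℕ) → Set₁
AgreeOn₁ L F G = ∀ q → L q → F q ≡ G q

Violation₁ : {P : Set₁} → (FD₁ P → Set₂) → (P → ℕ) → (P → ℕ) → Set₂
Violation₁ S F G = ∃ λ fd → S fd × AgreeOn₁ (lhs₁ fd) F G × F (rhs₁ fd) ≢ G (rhs₁ fd)

restrictLhs : {n : ℕ} (O : Fin n → Set₁) → (Fin n → Set) → PosIn O → Set
restrictLhs O L q = L (proj₁ q)

-- Σ_FD|_O : for every FD R^L → R^r of Σ_FD with L ⊆ O:
--   if R^r ∈ O, the FD itself;
--   if R^r ∉ O, the key dependency R^L → O, i.e. all R^L → R^o with R^o ∈ O.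
ProjFDs : {n : ℕ} → List (FD (Fin n)) → (O : Fin n → Set₁) → FD₁ (PosIn O) → Set₂
ProjFDs Σfd O g =
  ∃ λ fd → fd ∈ Σfd × (∀ q → lhs fd q → O q) ×
    (  (Σ (O (rhs fd)) λ o → g ≡ (restrictLhs O (lhs fd) ⟹ (rhs fd , o)))
     ⊎ (¬ O (rhs fd) × ∃ λ (o : PosIn O) → g ≡ (restrictLhs O (lhs fd) ⟹ o)))

module Submission where

-- Suppose some FD  L → r  of Σ_FD is violated by {F, F′}.  The two
-- facts agree on L, so L ⊆ OVL(F, F′) ⊆ O, hence the FD contributes to the
-- projection Σ_FD|_O.  Two cases, according to whether r lies in O:
--   * r ∈ O : the FD itself belongs to Σ_FD|_O, and the projected facts
--     still agree on L and still differ on r;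
--   * r ∉ O : the key dependency L → O belongs to Σ_FD|_O; since
--     OVL(F, F′) ⊊ O there is a position o ∈ O on which F and F′ differ,
--     so the member L → o of that key dependency is violated.
-- Either way {π_O F, π_O F′} violates Σ_FD|_O.  The case split on "r ∈ O"
-- is not decidable in general, but the goal is a negation, so the
-- excluded middle is available under double negation.
-- The argument works for every set of positions O; the theorem is the
-- instance O = NDng(R^p).

open import Defs
open import Data.Nat using (ℕ)
open import Data.Fin using (Fin)
open import Data.List using (List)
open import Data.List.Relation.Unary.All using (All)
open import Data.List.Membership.Propositional using (_∈_)
open import Data.Product using (_,_)
open import Data.Sum using (inj₁; inj₂)
open import Relation.Nullary using (¬_)
open import Relation.Binary.PropositionalEquality using (_≡_; refl)

module _ {n : ℕ} (Σfd : List (FD (Fin n))) (O : Fin n → Set₁) where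

  restrictTo : FD (Fin n) → PosIn O → FD₁ (PosIn O)
  restrictTo fd o = restrictLhs O (lhs fd) ⟹ o

  projectAgree : ∀ (L : Fin n → Set) {F G : Fact (Fin n)} →
    AgreeOn L F G → AgreeOn₁ (restrictLhs O L) (π O F) (π O G)
  projectAgree L agree (q , _) Lq = agree q Lq

  restrictedViolation : ∀ {F G : Fact (Fin n)} (fd : FD (Fin n)) (o : PosIn O) →
    ProjFDs Σfd O (restrictTo fd o) → AgreeOn (lhs fd) F G →
    ¬ π O F o ≡ π O G o → Violation₁ (ProjFDs Σfd O) (π O F) (π O G)
  restrictedViolation fd o member agree differ =
    restrictTo fd o , member , projectAgree (lhs fd) agree , differ

  noProjectedViolation⇒noViolation : ∀ {F G : Fact (Fin n)} →
    OVL F G ⊊ O →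
    ¬ Violation₁ (ProjFDs Σfd O) (π O F) (π O G) →
    ¬ Violation (λ fd → fd ∈ Σfd) F G
  noProjectedViolation⇒noViolation {F} {G} (ovl⊆O , o , Oo , F≢Gₒ) noProjected
                                   (fd , fd∈Σ , agree , F≢Gᵣ) =
    rhsOutside λ rhs∈O → rhsInside rhs∈O
    where
    lhs⊆O : ∀ q → lhs fd q → O q
    lhs⊆O q Lq = ovl⊆O q (agree q Lq)

    rhsInside : ¬ O (rhs fd)
    rhsInside rhs∈O = noProjected
      (restrictedViolation fd (rhs fd , rhs∈O)
        (fd , fd∈Σ , lhs⊆O , inj₁ (rhs∈O , refl)) agree F≢Gᵣ)

    rhsOutside : ¬ ¬ O (rhs fd)
    rhsOutside rhs∉O = noProjected
      (restrictedViolation fd (o , Oo)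
        (fd , fd∈Σ , lhs⊆O , inj₂ (rhs∉O , (o , Oo) , refl)) agree F≢Gₒ)

-- Theorem: the instance O = NDng(R^p) of the main lemma.
mainTheorem12 : ∀ {n : ℕ} (Σfd : List (FD (Fin n))) → All NonemptyLhs Σfd →
    (I : List (Fact (Fin n))) (F F′ : Fact (Fin n)) → F ∈ I → F′ ∈ I →
    ¬ (∀ q → F q ≡ F′ q) →
    (p : Fin n) →
    OVL F F′ ⊊ NDng Σfd p →
    ¬ Violation₁ (ProjFDs Σfd (NDng Σfd p)) (π (NDng Σfd p) F) (π (NDng Σfd p) F′) →
    ¬ Violation (λ fd → fd ∈ Σfd) F F′
mainTheorem12 Σfd _ _ _ _ _ _ _ p =
  noProjectedViolation⇒noViolation Σfd (NDng Σfd p)
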